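{- Let $P$ be a path graph with more than two nodes. Then the pure discrete Morse complex $\mathfrak{M}_{\mathrm{pure}}(P)$ is collapsible.
   Context: A graph is regarded as a one-dimensional simplicial complex. For a finite simplicial complex $\Delta$, its Hasse diagram is the graph whose vertices are the nonempty faces of $\Delta$, with an edge $\{f,g\}$ whenever $f\subset g$ and $\dim g=\dim f+1$. A matching $M$ of the Hasse diagram is acyclic if orienting every edge from the larger face to the smaller one, except edges of $M$ which are oriented from smaller to larger, yields a directed graph without directed cycles. The discrete Morse complex $\mathfrak{M}(\Delta)$ is the simplicial complex whose vertex set is the set of edges of the Hasse diagram and whose faces are the acyclic matchings. The pure discrete Morse complex $\mathfrak{M}_{\mathrm{pure}}(\Delta)$ is the subcomplex of $\mathfrak{M}(\Delta)$ generated by the facets of maximal dimension. -}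

module Defs where

open import Data.Nat using (ℕ; zero; suc; _*_; _≤_)
open import Data.Fin using (Fin; zero; suc; inject₁; remQuot)
open import Data.Fin.Subset using (Subset; _∈_; _∉_; _⊆_; ∣_∣; Nonempty; ⁅_⁆)
open import Data.Product using (Σ; ∃; ∃₂; _×_; _,_; proj₁; proj₂)
open import Data.Sum using (_⊎_; inj₁; inj₂)
open import Relation.Nullary using (¬_)
open import Relation.Binary.PropositionalEquality using (_≡_; _≢_)
open import Relation.Binary.Construct.Closure.Transitive using (TransClosure)
open import Relation.Binary.Construct.Closure.ReflexiveTransitive using (Star)
open import Function.Bundles using (_⇔_)
open import Level using (0ℓ)

record Graph : Set where
  field
    V    : ℕ
    E    : ℕ
    ends : Fin E → Fin 2 → Fin V
open Graph public

PathGraph : ℕ → Graph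
PathGraph zero = record { V = 0 ; E = 0 ; ends = λ () }
PathGraph (suc m) = record { V = suc m ; E = m ; ends = pe }
  where
  pe : Fin m → Fin 2 → Fin (suc m)
  pe e zero    = inject₁ e
  pe e (suc _) = suc e

-- Nodes: vertices (inj₁) and edges (inj₂) of G (the nonempty faces).
-- Hasse edges: indexed by Fin (E * 2); h ↦ (e , i) via remQuot, joining
-- the edge-node e with its endpoint ends e i.

HNode : Graph → Set
HNode G = Fin (V G) ⊎ Fin (E G)

HEdge : Graph → Set
HEdge G = Fin (E G * 2)

edgeOf : (G : Graph) → HEdge G → Fin (E G)
edgeOf G h = proj₁ (remQuot {E G} 2 h)

endOf : (G : Graph) → HEdge G → Fin (V G)
endOf G h = ends G (edgeOf G h) (proj₂ (remQuot {E G} 2 h))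

HSet : Graph → Set
HSet G = Subset (E G * 2)

data Arc (G : Graph) (M : HSet G) : HNode G → HNode G → Set where
  up   : ∀ h → h ∈ M → Arc G M (inj₁ (endOf G h)) (inj₂ (edgeOf G h))
  down : ∀ h → h ∉ M → Arc G M (inj₂ (edgeOf G h)) (inj₁ (endOf G h))

IsMatching : (G : Graph) → HSet G → Set
IsMatching G M = ∀ h h' → h ∈ M → h' ∈ M → h ≢ h' →
  (edgeOf G h ≢ edgeOf G h') × (endOf G h ≢ endOf G h')

IsAcyclic : (G : Graph) → HSet G → Set
IsAcyclic G M = ∀ x → ¬ TransClosure (Arc G M) x x

AcyclicMatching : (G : Graph) → HSet G → Set
AcyclicMatching G M = IsMatching G M × IsAcyclic G M

-- Finite simplicial complexes on vertex set Fin m, given by their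
-- set of NONEMPTY faces.

Complex : ℕ → Set₁
Complex m = Subset m → Set

MorseComplex : (G : Graph) → Complex (E G * 2)
MorseComplex G σ = Nonempty σ × AcyclicMatching G σ

PureMorseComplex : (G : Graph) → Complex (E G * 2)
PureMorseComplex G σ =
  Nonempty σ ×
  ∃ λ M → AcyclicMatching G M ×
          (∀ M' → AcyclicMatching G M' → ∣ M' ∣ ≤ ∣ M ∣) ×
          σ ⊆ M

ElemCollapse : ∀ {m} → Complex m → Complex m → Set
ElemCollapse {m} K L =
  ∃₂ λ (σ τ : Subset m) →
    K σ × K τ × Nonempty σ × σ ⊆ τ × ∣ τ ∣ ≡ suc ∣ σ ∣ ×
    (∀ ρ → K ρ → σ ⊆ ρ → (ρ ≡ σ) ⊎ (ρ ≡ τ)) ×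
    (∀ ρ → L ρ ⇔ (K ρ × ¬ (σ ⊆ ρ)))

Collapsible : ∀ {m} → Complex m → Set₁
Collapsible {m} K =
  ∃ λ (L : Complex m) → Star ElemCollapse K L ×
    ∃ λ (v : Fin m) → ∀ ρ → L ρ ⇔ (ρ ≡ ⁅ v ⁆)

-- A matching of the Hasse diagram of the path with N edges uses each edge at most once, and the
-- gradient towards any vertex k (edges left of k matched to their left endpoint, the others to
-- their right one) is an acyclic matching using all N.  So the maximum acyclic matchings use
-- every edge exactly once, and since an edge matched right forces the next one to be matched
-- right as well (they would share a vertex), they are exactly these N + 1 gradients.  The pure
-- complex is therefore the union of the simplices Δ₀, …, Δ_N they span.  Consecutive Δ_k and
-- Δ_{k+1} differ only at edge k, and the vertex "edge k matched left" lies in Δ_{k+1} alone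
-- among Δ₀, …, Δ_{k+1}; its link there is a cone, so it can be collapsed away, from k = N - 1
-- down to k = 0.  What remains is the simplex Δ₀, which collapses to a vertex.

module Submission where

open import Defs
open import Data.Nat using (ℕ; zero; suc; _+_; _*_; _<_; _≤_; z≤n; s≤s; ∣_-_∣)
open import Data.Nat.Properties
  using (n≮0; n≤1+n; m≤n⇒m≤1+n; ≤-refl; ≤-reflexive; ≤-trans; ≤-antisym; ≤-pred; <-irrefl; <-trans;
         <-≤-trans; <⇒≤; <⇒≱; ≮⇒≥; ≰⇒>; m≤n⇒m<n∨m≡n; *-suc; *-monoʳ-<; *-monoʳ-≤; anyUpTo?)
open import Data.Fin using (Fin; zero; suc; _≟_; toℕ; inject₁; fromℕ<; combine; remQuot)
open import Data.Fin.Properties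
  using (0≢1+n; suc-injective; toℕ-inject₁; inject₁-injective; toℕ-fromℕ<; combine-injectiveʳ;
         combine-remQuot; remQuot-combine)
open import Data.Fin.Subset using (Subset; _∈_; _∉_; _⊆_; ∣_∣; Nonempty; ⁅_⁆; _∪_; _─_; inside; outside)
open import Data.Fin.Subset.Properties
  using (_∈?_; _⊆?_; nonempty?; x∈⁅x⁆; x∈⁅y⁆⇒x≡y; ⊆-antisym; p⊆p∪q; x∈p∪q⁻; x∈p∪q⁺; ∪-identityʳ;
         x∈p∧x≢y⇒x∈p-y; p─q⊆p)
open import Data.Vec using ([]; _∷_; here; there)
open import Data.List using (List; []; _∷_; allFin)
open import Data.List.Relation.Unary.Any using (here; there)
open import Data.List.Membership.Propositional using () renaming (_∈_ to _∈ₗ_)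
open import Data.List.Membership.Propositional.Properties using (∈-allFin)
open import Data.Product using (∃; _×_; _,_; proj₁; proj₂; uncurry)
open import Data.Empty using (⊥-elim)
open import Data.Sum using (_⊎_; inj₁; inj₂; [_,_])
open import Function using (id; _∘_)
open import Function.Bundles using (mk⇔; module Equivalence)
open import Relation.Nullary using (¬_; yes; no; contradiction)
open import Relation.Nullary.Decidable using (_×-dec_; ¬?; map′)
open import Relation.Unary using (Decidable; _≐_)
open import Relation.Unary.Properties using (≐-refl; ≐-sym; ≐-trans)
open import Relation.Binary.PropositionalEquality
  using (_≡_; _≢_; refl; sym; trans; cong; cong₂; subst; module ≡-Reasoning)
open import Relation.Binary.Construct.Closure.Transitive using (TransClosure; _∷_) renaming ([_] to [_]⁺)
open import Relation.Binary.Construct.Closure.ReflexiveTransitive using (Star; ε; _◅_; _◅◅_)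

private variable
  m : ℕ
  K K′ L X Y : Complex m
  F G ρ σ : Subset m
  u v w : Fin m
  us : List (Fin m)
  N k j : ℕ

x∈p⇒⁅x⁆⊆p : v ∈ σ → ⁅ v ⁆ ⊆ σ
x∈p⇒⁅x⁆⊆p {v = v} {σ = σ} v∈σ x∈⁅v⁆ = subst (_∈ σ) (sym (x∈⁅y⁆⇒x≡y v x∈⁅v⁆)) v∈σ

p⊆q∧x∈q⇒p∪⁅x⁆⊆q : F ⊆ ρ → v ∈ ρ → F ∪ ⁅ v ⁆ ⊆ ρ
p⊆q∧x∈q⇒p∪⁅x⁆⊆q {F = F} {v = v} F⊆ρ v∈ρ x∈ = [ F⊆ρ , x∈p⇒⁅x⁆⊆p v∈ρ ] (x∈p∪q⁻ F ⁅ v ⁆ x∈)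

x∉p⇒∣p∪⁅x⁆∣≡1+∣p∣ : v ∉ σ → ∣ σ ∪ ⁅ v ⁆ ∣ ≡ suc ∣ σ ∣
x∉p⇒∣p∪⁅x⁆∣≡1+∣p∣ {v = zero}  {σ = inside  ∷ σ} v∉σ = contradiction here v∉σ
x∉p⇒∣p∪⁅x⁆∣≡1+∣p∣ {v = zero}  {σ = outside ∷ σ} v∉σ = cong (λ τ → suc ∣ τ ∣) (∪-identityʳ σ)
x∉p⇒∣p∪⁅x⁆∣≡1+∣p∣ {v = suc v} {σ = inside  ∷ σ} v∉σ = cong suc (x∉p⇒∣p∪⁅x⁆∣≡1+∣p∣ (v∉σ ∘ there))
x∉p⇒∣p∪⁅x⁆∣≡1+∣p∣ {v = suc v} {σ = outside ∷ σ} v∉σ = x∉p⇒∣p∪⁅x⁆∣≡1+∣p∣ (v∉σ ∘ there)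

x∉p─⁅x⁆ : ∀ (σ : Subset m) v → v ∉ σ ─ ⁅ v ⁆
x∉p─⁅x⁆ (_ ∷ σ) zero    ()
x∉p─⁅x⁆ (_ ∷ σ) (suc v) (there v∈) = x∉p─⁅x⁆ σ v v∈

infix 4 _↘_
_↘_ : Complex m → Complex m → Set₁
K ↘ X = ∃ λ L → Star ElemCollapse K L × L ≐ X

↘-reflexive : K ≐ X → K ↘ X
↘-reflexive {K = K} K≐X = K , ε , K≐X

elemCollapse-respˡ-≐ : K ≐ K′ → ElemCollapse K′ L → ElemCollapse K L
elemCollapse-respˡ-≐ (K⊆K′ , K′⊆K) (σ , τ , K′σ , K′τ , σ≠∅ , σ⊆τ , ∣τ∣≡1+∣σ∣ , cofaces , L≡) =
  σ , τ , K′⊆K K′σ , K′⊆K K′τ , σ≠∅ , σ⊆τ , ∣τ∣≡1+∣σ∣ ,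
  (λ ρ Kρ → cofaces ρ (K⊆K′ Kρ)) ,
  λ ρ → mk⇔ (λ Lρ → let (K′ρ , σ⊈ρ) = Equivalence.to (L≡ ρ) Lρ in K′⊆K K′ρ , σ⊈ρ)
            (λ (Kρ , σ⊈ρ) → Equivalence.from (L≡ ρ) (K⊆K′ Kρ , σ⊈ρ))

↘-respˡ-≐ : K ≐ K′ → K′ ↘ X → K ↘ X
↘-respˡ-≐ K≐K′ (L , ε     , L≐X) = ↘-reflexive (≐-trans K≐K′ L≐X)
↘-respˡ-≐ K≐K′ (L , c ◅ s , L≐X) = L , elemCollapse-respˡ-≐ K≐K′ c ◅ s , L≐X

↘-respʳ-≐ : K ↘ X → X ≐ Y → K ↘ Y
↘-respʳ-≐ (L , s , L≐X) X≐Y = L , s , ≐-trans L≐X X≐Y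

↘-trans : K ↘ X → X ↘ Y → K ↘ Y
↘-trans (L , s , L≐X) X↘Y with ↘-respˡ-≐ L≐X X↘Y
... | L′ , s′ , L′≐Y = L′ , s ◅◅ s′ , L′≐Y

↘-vertex⇒collapsible : K ↘ (_≡ ⁅ v ⁆) → Collapsible K
↘-vertex⇒collapsible {v = v} (L , s , (L⊆ , ⊆L)) = L , s , v , λ ρ → mk⇔ L⊆ ⊆L

DownClosed : Complex m → Set
DownClosed K = ∀ {ρ ρ′} → K ρ → Nonempty ρ′ → ρ′ ⊆ ρ → K ρ′

deletion : Complex m → Subset m → Complex m
deletion K F ρ = K ρ × ¬ F ⊆ ρ

deletion-downClosed : DownClosed K → DownClosed (deletion K F)
deletion-downClosed closed (Kρ , F⊈ρ) ρ′≠∅ ρ′⊆ρ = closed Kρ ρ′≠∅ ρ′⊆ρ , λ F⊆ρ′ → F⊈ρ (ρ′⊆ρ ∘ F⊆ρ′)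

deletion-decidable : Decidable K → Decidable (deletion K F)
deletion-decidable {F = F} K? ρ = K? ρ ×-dec ¬? (F ⊆? ρ)

deletion-deletion : F ⊆ G → deletion (deletion K G) F ≐ deletion K F
deletion-deletion F⊆G = (λ ((Kρ , _) , F⊈ρ) → Kρ , F⊈ρ)
                      , (λ (Kρ , F⊈ρ) → (Kρ , λ G⊆ρ → F⊈ρ (G⊆ρ ∘ F⊆G)) , F⊈ρ)

StarIsCone : Complex m → Subset m → Fin m → Set
StarIsCone K F w = ∀ {ρ} → K ρ → F ⊆ ρ → K (ρ ∪ ⁅ w ⁆)

freeFace-↘ : DownClosed K → Decidable K → Nonempty F → w ∉ F → StarIsCone K F w →
             (∀ {ρ} → K ρ → F ⊆ ρ → ρ ⊆ F ∪ ⁅ w ⁆) → K ↘ deletion K F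
freeFace-↘ {K = K} {F = F} {w = w} closed K? F≠∅ w∉F cone bounded with K? F
... | no F∉K = ↘-reflexive ((λ Kρ → Kρ , F∉K ∘ closed Kρ F≠∅) , proj₁)
... | yes F∈K = deletion K F , freePair ◅ ε , ≐-refl
  where
  cofaces : ∀ ρ → K ρ → F ⊆ ρ → ρ ≡ F ⊎ ρ ≡ F ∪ ⁅ w ⁆
  cofaces ρ Kρ F⊆ρ with w ∈? ρ
  ... | yes w∈ρ = inj₂ (⊆-antisym (bounded Kρ F⊆ρ) (p⊆q∧x∈q⇒p∪⁅x⁆⊆q F⊆ρ w∈ρ))
  ... | no  w∉ρ = inj₁ (⊆-antisym ρ⊆F F⊆ρ)
    where
    ρ⊆F : ρ ⊆ F
    ρ⊆F {x} x∈ρ with x∈p∪q⁻ F ⁅ w ⁆ (bounded Kρ F⊆ρ x∈ρ)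
    ... | inj₁ x∈F   = x∈F
    ... | inj₂ x∈⁅w⁆ = contradiction (subst (_∈ ρ) (x∈⁅y⁆⇒x≡y w x∈⁅w⁆) x∈ρ) w∉ρ
  freePair : ElemCollapse K (deletion K F)
  freePair = F , F ∪ ⁅ w ⁆ , F∈K , cone F∈K id , F≠∅ , p⊆p∪q ⁅ w ⁆ , x∉p⇒∣p∪⁅x⁆∣≡1+∣p∣ w∉F ,
             cofaces , λ _ → mk⇔ id id

StarWithin : Complex m → Subset m → Fin m → List (Fin m) → Set
StarWithin K F w us = ∀ {ρ u} → K ρ → F ⊆ ρ → u ∈ ρ → u ∈ F ⊎ u ≡ w ⊎ u ∈ₗ us

starWithin-drop : u ∈ F ⊎ u ≡ w → StarWithin K F w (u ∷ us) → StarWithin K F w us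
starWithin-drop u∈F⊎u≡w within Kρ F⊆ρ x∈ρ with within Kρ F⊆ρ x∈ρ
... | inj₁ x∈F               = inj₁ x∈F
... | inj₂ (inj₁ x≡w)        = inj₂ (inj₁ x≡w)
... | inj₂ (inj₂ (here refl)) = [ inj₁ , inj₂ ∘ inj₁ ] u∈F⊎u≡w
... | inj₂ (inj₂ (there x∈us)) = inj₂ (inj₂ x∈us)

starWithin-∪ : StarWithin K F w (u ∷ us) → StarWithin K (F ∪ ⁅ u ⁆) w us
starWithin-∪ {F = F} {u = u} within Kρ G⊆ρ x∈ρ with within Kρ (G⊆ρ ∘ p⊆p∪q ⁅ u ⁆) x∈ρ
... | inj₁ x∈F                 = inj₁ (p⊆p∪q ⁅ u ⁆ x∈F)
... | inj₂ (inj₁ x≡w)          = inj₂ (inj₁ x≡w)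
... | inj₂ (inj₂ (here refl))  = inj₁ (x∈p∪q⁺ (inj₂ (x∈⁅x⁆ u)))
... | inj₂ (inj₂ (there x∈us)) = inj₂ (inj₂ x∈us)

starWithin-deletion : StarWithin K F w (u ∷ us) → StarWithin (deletion K (F ∪ ⁅ u ⁆)) F w us
starWithin-deletion within (Kρ , G⊈ρ) F⊆ρ x∈ρ with within Kρ F⊆ρ x∈ρ
... | inj₁ x∈F                 = inj₁ x∈F
... | inj₂ (inj₁ x≡w)          = inj₂ (inj₁ x≡w)
... | inj₂ (inj₂ (here refl))  = ⊥-elim (G⊈ρ (p⊆q∧x∈q⇒p∪⁅x⁆⊆q F⊆ρ x∈ρ))
... | inj₂ (inj₂ (there x∈us)) = inj₂ (inj₂ x∈us)

starIsCone-deletion : u ≢ w → StarIsCone K F w → StarIsCone (deletion K (F ∪ ⁅ u ⁆)) F w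
starIsCone-deletion {u = u} {w = w} {F = F} u≢w cone (Kρ , G⊈ρ) F⊆ρ = cone Kρ F⊆ρ , G⊈ρ∪w G⊈ρ F⊆ρ
  where
  G⊈ρ∪w : ¬ F ∪ ⁅ u ⁆ ⊆ ρ → F ⊆ ρ → ¬ F ∪ ⁅ u ⁆ ⊆ ρ ∪ ⁅ w ⁆
  G⊈ρ∪w {ρ = ρ} G⊈ρ F⊆ρ G⊆ρ∪w with x∈p∪q⁻ ρ ⁅ w ⁆ (G⊆ρ∪w (x∈p∪q⁺ (inj₂ (x∈⁅x⁆ u))))
  ... | inj₁ u∈ρ   = G⊈ρ (p⊆q∧x∈q⇒p∪⁅x⁆⊆q F⊆ρ u∈ρ)
  ... | inj₂ u∈⁅w⁆ = u≢w (x∈⁅y⁆⇒x≡y w u∈⁅w⁆)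

-- Induction on the vertices us not yet excluded from faces containing F: for each further
-- vertex u, first remove the faces containing F ∪ {u}; when none is left, F is a free face of
-- F ∪ {w}.
starDeletion-↘ : ∀ us → DownClosed K → Decidable K → Nonempty F → w ∉ F →
                 StarIsCone K F w → StarWithin K F w us → K ↘ deletion K F
starDeletion-↘ {K = K} {F = F} {w = w} [] closed K? F≠∅ w∉F cone within =
  freeFace-↘ closed K? F≠∅ w∉F cone bounded
  where
  bounded : ∀ {ρ} → K ρ → F ⊆ ρ → ρ ⊆ F ∪ ⁅ w ⁆
  bounded Kρ F⊆ρ x∈ρ with within Kρ F⊆ρ x∈ρ
  ... | inj₁ x∈F    = p⊆p∪q ⁅ w ⁆ x∈F
  ... | inj₂ (inj₁ refl) = x∈p∪q⁺ (inj₂ (x∈⁅x⁆ w))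
starDeletion-↘ {K = K} {F = F} {w = w} (u ∷ us) closed K? F≠∅ w∉F cone within with u ∈? F | u ≟ w
... | yes u∈F | _        = starDeletion-↘ us closed K? F≠∅ w∉F cone (starWithin-drop (inj₁ u∈F) within)
... | no _    | yes u≡w  = starDeletion-↘ us closed K? F≠∅ w∉F cone (starWithin-drop (inj₂ u≡w) within)
... | no u∉F  | no u≢w   = ↘-trans removeStarOfF∪u (↘-respʳ-≐ removeRestOfStarOfF (deletion-deletion F⊆F∪u))
  where
  F⊆F∪u : F ⊆ F ∪ ⁅ u ⁆
  F⊆F∪u = p⊆p∪q ⁅ u ⁆
  w∉F∪u : w ∉ F ∪ ⁅ u ⁆
  w∉F∪u w∈F∪u = [ w∉F , (λ w∈⁅u⁆ → u≢w (sym (x∈⁅y⁆⇒x≡y u w∈⁅u⁆))) ] (x∈p∪q⁻ F ⁅ u ⁆ w∈F∪u)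
  removeStarOfF∪u : K ↘ deletion K (F ∪ ⁅ u ⁆)
  removeStarOfF∪u = starDeletion-↘ us closed K? (u , x∈p∪q⁺ (inj₂ (x∈⁅x⁆ u))) w∉F∪u
                      (λ Kρ F∪u⊆ρ → cone Kρ (F∪u⊆ρ ∘ F⊆F∪u)) (starWithin-∪ within)
  removeRestOfStarOfF : deletion K (F ∪ ⁅ u ⁆) ↘ deletion (deletion K (F ∪ ⁅ u ⁆)) F
  removeRestOfStarOfF = starDeletion-↘ us (deletion-downClosed closed) (deletion-decidable K?) F≠∅ w∉F
                          (starIsCone-deletion u≢w cone) (starWithin-deletion within)

vertexDeletion-↘ : DownClosed K → Decidable K → w ≢ v → (∀ {ρ} → K ρ → v ∈ ρ → K (ρ ∪ ⁅ w ⁆)) →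
                   K ↘ (λ ρ → K ρ × v ∉ ρ)
vertexDeletion-↘ {K = K} {w = w} {v = v} closed K? w≢v cone =
  ↘-respʳ-≐ (starDeletion-↘ (allFin _) closed K? (v , x∈⁅x⁆ v) (w≢v ∘ x∈⁅y⁆⇒x≡y v)
               (λ Kρ v⊆ρ → cone Kρ (v⊆ρ (x∈⁅x⁆ v))) (λ {_} {u} _ _ _ → inj₂ (inj₂ (∈-allFin u))))
            ((λ (Kρ , v⊈ρ) → Kρ , v⊈ρ ∘ x∈p⇒⁅x⁆⊆p) , (λ (Kρ , v∉ρ) → Kρ , λ v⊆ρ → v∉ρ (v⊆ρ (x∈⁅x⁆ v))))

Simplex : Subset m → Complex m
Simplex σ ρ = Nonempty ρ × ρ ⊆ σ

simplex-downClosed : DownClosed (Simplex σ)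
simplex-downClosed (_ , ρ⊆σ) ρ′≠∅ ρ′⊆ρ = ρ′≠∅ , ρ⊆σ ∘ ρ′⊆ρ

simplex-decidable : Decidable (Simplex σ)
simplex-decidable {σ = σ} ρ = nonempty? ρ ×-dec ρ ⊆? σ

simplex-─⁅x⁆ : Simplex (σ ─ ⁅ v ⁆) ≐ (λ ρ → Simplex σ ρ × v ∉ ρ)
simplex-─⁅x⁆ {σ = σ} {v = v} =
  (λ (ρ≠∅ , ρ⊆σ-v) → (ρ≠∅ , p─q⊆p σ ⁅ v ⁆ ∘ ρ⊆σ-v) , x∉p─⁅x⁆ σ v ∘ ρ⊆σ-v)
  , λ ((ρ≠∅ , ρ⊆σ) , v∉ρ) → ρ≠∅ , λ x∈ρ → x∈p∧x≢y⇒x∈p-y (ρ⊆σ x∈ρ) λ { refl → v∉ρ x∈ρ }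

simplex≐vertex : w ∈ σ → σ ⊆ ⁅ w ⁆ → Simplex σ ≐ (_≡ ⁅ w ⁆)
simplex≐vertex {w = w} w∈σ σ⊆w =
  (λ ((x , x∈ρ) , ρ⊆σ) → ⊆-antisym (σ⊆w ∘ ρ⊆σ)
                           (x∈p⇒⁅x⁆⊆p (subst (_∈ _) (x∈⁅y⁆⇒x≡y w (σ⊆w (ρ⊆σ x∈ρ))) x∈ρ)))
  , λ { refl → (w , x∈⁅x⁆ w) , x∈p⇒⁅x⁆⊆p w∈σ }

simplex-↘-vertex-listed : ∀ us → w ∈ σ → (∀ {x} → x ∈ σ → x ≡ w ⊎ x ∈ₗ us) → Simplex σ ↘ (_≡ ⁅ w ⁆)
simplex-↘-vertex-listed {w = w} {σ = σ} [] w∈σ covered = ↘-reflexive (simplex≐vertex w∈σ σ⊆w)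
  where
  σ⊆w : σ ⊆ ⁅ w ⁆
  σ⊆w x∈σ with covered x∈σ
  ... | inj₁ refl = x∈⁅x⁆ w
simplex-↘-vertex-listed {w = w} {σ = σ} (u ∷ us) w∈σ covered with u ≟ w
... | yes refl = simplex-↘-vertex-listed us w∈σ covered′
  where
  covered′ : ∀ {x} → x ∈ σ → x ≡ w ⊎ x ∈ₗ us
  covered′ x∈σ with covered x∈σ
  ... | inj₁ x≡w          = inj₁ x≡w
  ... | inj₂ (here x≡w)   = inj₁ x≡w
  ... | inj₂ (there x∈us) = inj₂ x∈us
... | no u≢w   = ↘-trans (↘-respʳ-≐ (vertexDeletion-↘ simplex-downClosed simplex-decidable (u≢w ∘ sym) cone)
                                    (≐-sym simplex-─⁅x⁆))
                         (simplex-↘-vertex-listed us (x∈p∧x≢y⇒x∈p-y w∈σ (u≢w ∘ sym)) covered′)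
  where
  cone : ∀ {ρ} → Simplex σ ρ → u ∈ ρ → Simplex σ (ρ ∪ ⁅ w ⁆)
  cone ((x , x∈ρ) , ρ⊆σ) _ = (x , p⊆p∪q ⁅ w ⁆ x∈ρ) , p⊆q∧x∈q⇒p∪⁅x⁆⊆q ρ⊆σ w∈σ
  covered′ : ∀ {x} → x ∈ σ ─ ⁅ u ⁆ → x ≡ w ⊎ x ∈ₗ us
  covered′ x∈σ-u with covered (p─q⊆p σ ⁅ u ⁆ x∈σ-u)
  ... | inj₁ x≡w          = inj₁ x≡w
  ... | inj₂ (here refl)  = contradiction x∈σ-u (x∉p─⁅x⁆ σ u)
  ... | inj₂ (there x∈us) = inj₂ x∈us

simplex-↘-vertex : w ∈ σ → Simplex σ ↘ (_≡ ⁅ w ⁆)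
simplex-↘-vertex w∈σ = simplex-↘-vertex-listed (allFin _) w∈σ (λ {x} _ → inj₂ (∈-allFin x))

isAcyclic-byPotential : ∀ {G M} (φ : HNode G → ℕ) → (∀ {x y} → Arc G M x y → φ y < φ x) →
                        IsAcyclic G M
isAcyclic-byPotential {G} {M} φ descends x cycle = <-irrefl refl (descent cycle)
  where
  descent : ∀ {x y} → TransClosure (Arc G M) x y → φ y < φ x
  descent [ a ]⁺     = descends a
  descent (a ∷ path) = <-trans (descent path) (descends a)

∣m-n∣≡1+∣1+m-n∣ : ∀ {m n} → m < n → ∣ m - n ∣ ≡ suc ∣ suc m - n ∣
∣m-n∣≡1+∣1+m-n∣ {zero}  {suc n} _         = refl
∣m-n∣≡1+∣1+m-n∣ {suc m} {suc n} (s≤s m<n) = ∣m-n∣≡1+∣1+m-n∣ m<n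

∣1+m-n∣≡1+∣m-n∣ : ∀ {m n} → n ≤ m → ∣ suc m - n ∣ ≡ suc ∣ m - n ∣
∣1+m-n∣≡1+∣m-n∣ {zero}  {zero}  _         = refl
∣1+m-n∣≡1+∣m-n∣ {suc m} {zero}  _         = refl
∣1+m-n∣≡1+∣m-n∣ {suc m} {suc n} (s≤s n≤m) = ∣1+m-n∣≡1+∣m-n∣ n≤m

Path : ℕ → Graph
Path N = PathGraph (suc N)

-- left e and right e are the Hasse edges joining edge e of the path to its endpoints e and e + 1.
left right : Fin N → Fin (N * 2)
left  e = combine e zero
right e = combine e (suc zero)

-- The gradient with critical vertex k: edges e < k are matched to their left endpoint, the
-- others to their right one.
gradientTo : ∀ N → ℕ → Subset (N * 2)
gradientTo zero    _       = []
gradientTo (suc N) zero    = outside ∷ inside  ∷ gradientTo N zero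
gradientTo (suc N) (suc k) = inside  ∷ outside ∷ gradientTo N k

left∈gradientTo⁺ : ∀ {e : Fin N} → toℕ e < k → left e ∈ gradientTo N k
left∈gradientTo⁺ {k = suc k} {e = zero}  _         = here
left∈gradientTo⁺ {k = suc k} {e = suc e} (s≤s e<k) = there (there (left∈gradientTo⁺ e<k))

left∈gradientTo⁻ : ∀ {e : Fin N} → left e ∈ gradientTo N k → toℕ e < k
left∈gradientTo⁻ {k = zero}  {e = zero}  ()
left∈gradientTo⁻ {k = zero}  {e = suc e} (there (there l∈)) = ⊥-elim (n≮0 (left∈gradientTo⁻ l∈))
left∈gradientTo⁻ {k = suc k} {e = zero}  _                  = s≤s z≤n
left∈gradientTo⁻ {k = suc k} {e = suc e} (there (there l∈)) = s≤s (left∈gradientTo⁻ l∈)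

right∈gradientTo⁺ : ∀ {e : Fin N} → k ≤ toℕ e → right e ∈ gradientTo N k
right∈gradientTo⁺ {k = zero}  {e = zero}  _         = there here
right∈gradientTo⁺ {k = zero}  {e = suc e} _         = there (there (right∈gradientTo⁺ z≤n))
right∈gradientTo⁺ {k = suc k} {e = suc e} (s≤s k≤e) = there (there (right∈gradientTo⁺ k≤e))

right∈gradientTo⁻ : ∀ {e : Fin N} → right e ∈ gradientTo N k → k ≤ toℕ e
right∈gradientTo⁻ {k = zero}              _                  = z≤n
right∈gradientTo⁻ {k = suc k} {e = zero}  (there ())
right∈gradientTo⁻ {k = suc k} {e = suc e} (there (there r∈)) = s≤s (right∈gradientTo⁻ r∈)

∣gradientTo∣≡N : ∀ N k → ∣ gradientTo N k ∣ ≡ N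
∣gradientTo∣≡N zero    _       = refl
∣gradientTo∣≡N (suc N) zero    = cong suc (∣gradientTo∣≡N N zero)
∣gradientTo∣≡N (suc N) (suc k) = cong suc (∣gradientTo∣≡N N k)

gradientTo-suc-⊆ : ∀ {h} (e : Fin N) → h ∈ gradientTo N (suc (toℕ e)) → h ≢ left e → h ∈ gradientTo N (toℕ e)
gradientTo-suc-⊆ zero    here               h≢l = ⊥-elim (h≢l refl)
gradientTo-suc-⊆ zero    (there (there h∈)) _   = there (there h∈)
gradientTo-suc-⊆ (suc e) here               _   = here
gradientTo-suc-⊆ (suc e) (there (there h∈)) h≢l =
  there (there (gradientTo-suc-⊆ e h∈ (λ h≡l → h≢l (cong (λ x → suc (suc x)) h≡l))))

EdgesMatchedOnce : ∀ N → Subset (N * 2) → Set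
EdgesMatchedOnce N M = ∀ (e : Fin N) → left e ∈ M → right e ∉ M

InnerVerticesMatchedOnce : ∀ N → Subset (N * 2) → Set
InnerVerticesMatchedOnce N M = ∀ (e e′ : Fin N) → suc e ≡ inject₁ e′ → right e ∈ M → left e′ ∉ M

edgesMatchedOnce-tail : ∀ {x y M} → EdgesMatchedOnce (suc N) (x ∷ y ∷ M) → EdgesMatchedOnce N M
edgesMatchedOnce-tail once e l∈ r∈ = once (suc e) (there (there l∈)) (there (there r∈))

innerVerticesMatchedOnce-tail : ∀ {x y M} →
                                InnerVerticesMatchedOnce (suc N) (x ∷ y ∷ M) → InnerVerticesMatchedOnce N M
innerVerticesMatchedOnce-tail once e e′ eq r∈ l∈ =
  once (suc e) (suc e′) (cong suc eq) (there (there r∈)) (there (there l∈))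

edgesMatchedOnce⇒∣M∣≤N : ∀ N {M} → EdgesMatchedOnce N M → ∣ M ∣ ≤ N
edgesMatchedOnce⇒∣M∣≤N zero    {[]}                    _    = z≤n
edgesMatchedOnce⇒∣M∣≤N (suc N) {inside  ∷ inside  ∷ M} once = contradiction (there here) (once zero here)
edgesMatchedOnce⇒∣M∣≤N (suc N) {inside  ∷ outside ∷ M} once =
  s≤s (edgesMatchedOnce⇒∣M∣≤N N (edgesMatchedOnce-tail once))
edgesMatchedOnce⇒∣M∣≤N (suc N) {outside ∷ inside  ∷ M} once =
  s≤s (edgesMatchedOnce⇒∣M∣≤N N (edgesMatchedOnce-tail once))
edgesMatchedOnce⇒∣M∣≤N (suc N) {outside ∷ outside ∷ M} once =
  m≤n⇒m≤1+n (edgesMatchedOnce⇒∣M∣≤N N (edgesMatchedOnce-tail once))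

matchedOnce⇒gradientTo : ∀ N {M} → EdgesMatchedOnce N M → InnerVerticesMatchedOnce N M → N ≤ ∣ M ∣ →
                         ∃ λ k → k ≤ N × M ≡ gradientTo N k
matchedOnce⇒gradientTo zero    {[]}                    _     _     _       = 0 , z≤n , refl
matchedOnce⇒gradientTo (suc N) {inside  ∷ inside  ∷ M} edges _     _       =
  contradiction (there here) (edges zero here)
matchedOnce⇒gradientTo (suc N) {outside ∷ outside ∷ M} edges _     1+N≤∣M∣ =
  contradiction 1+N≤∣M∣ (<⇒≱ (s≤s (edgesMatchedOnce⇒∣M∣≤N N (edgesMatchedOnce-tail edges))))
matchedOnce⇒gradientTo (suc N) {inside  ∷ outside ∷ M} edges inner (s≤s N≤∣M∣)
  with matchedOnce⇒gradientTo N (edgesMatchedOnce-tail edges) (innerVerticesMatchedOnce-tail inner) N≤∣M∣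
... | k , k≤N , refl = suc k , s≤s k≤N , refl
matchedOnce⇒gradientTo (suc N) {outside ∷ inside  ∷ M} edges inner (s≤s N≤∣M∣)
  with matchedOnce⇒gradientTo N (edgesMatchedOnce-tail edges) (innerVerticesMatchedOnce-tail inner) N≤∣M∣
... | zero  , _     , refl = zero , z≤n , refl
... | suc k , s≤s _ , refl = contradiction (there (there here)) (inner zero (suc zero) refl (there here))

module _ (N : ℕ) where

  side : Fin (N * 2) → Fin 2
  side h = proj₂ (remQuot {N} 2 h)

  combine-edgeOf-side : ∀ h → combine (edgeOf (Path N) h) (side h) ≡ h
  combine-edgeOf-side h = combine-remQuot {N} 2 h

  edgeOf-combine : ∀ (e : Fin N) i → edgeOf (Path N) (combine e i) ≡ e
  edgeOf-combine e i = cong proj₁ (remQuot-combine e i)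

  endOf-combine : ∀ (e : Fin N) i → endOf (Path N) (combine e i) ≡ ends (Path N) e i
  endOf-combine e i = cong (uncurry (ends (Path N))) (remQuot-combine e i)

  Towards : ℕ → Fin N → Fin 2 → Set
  Towards k e zero    = toℕ e < k
  Towards k e (suc _) = k ≤ toℕ e

  combine∈gradientTo⁻ : ∀ e i → combine e i ∈ gradientTo N k → Towards k e i
  combine∈gradientTo⁻ e zero       = left∈gradientTo⁻
  combine∈gradientTo⁻ e (suc zero) = right∈gradientTo⁻

  combine∈gradientTo⁺ : ∀ e i → Towards k e i → combine e i ∈ gradientTo N k
  combine∈gradientTo⁺ e zero       = left∈gradientTo⁺
  combine∈gradientTo⁺ e (suc zero) = right∈gradientTo⁺

  ∈gradientTo⇒Towards : ∀ {h} → h ∈ gradientTo N k → Towards k (edgeOf (Path N) h) (side h)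
  ∈gradientTo⇒Towards {k} {h} h∈ =
    combine∈gradientTo⁻ _ (side h) (subst (_∈ gradientTo N k) (sym (combine-edgeOf-side h)) h∈)

  Towards⇒∈gradientTo : ∀ {h} → Towards k (edgeOf (Path N) h) (side h) → h ∈ gradientTo N k
  Towards⇒∈gradientTo {k} {h} t =
    subst (_∈ gradientTo N k) (combine-edgeOf-side h) (combine∈gradientTo⁺ _ (side h) t)

  Towards-functional : ∀ {e : Fin N} i j → Towards k e i → Towards k e j → i ≡ j
  Towards-functional zero       zero       _   _   = refl
  Towards-functional zero       (suc zero) e<k k≤e = contradiction k≤e (<⇒≱ e<k)
  Towards-functional (suc zero) zero       k≤e e<k = contradiction k≤e (<⇒≱ e<k)
  Towards-functional (suc zero) (suc zero) _   _   = refl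

  inject₁≢suc : ∀ {e e′ : Fin N} → toℕ e < k → k ≤ toℕ e′ → inject₁ e ≢ suc e′
  inject₁≢suc {e = e} {e′} e<k k≤e′ e≡1+e′ = <⇒≱ (<-≤-trans e<k k≤e′) e′≤e
    where
    e′≤e : toℕ e′ ≤ toℕ e
    e′≤e = ≤-trans (n≤1+n (toℕ e′)) (≤-reflexive (trans (sym (cong toℕ e≡1+e′)) (toℕ-inject₁ e)))

  Towards-ends-injective : ∀ {e e′ : Fin N} i j → Towards k e i → Towards k e′ j →
                           ends (Path N) e i ≡ ends (Path N) e′ j → e ≡ e′
  Towards-ends-injective zero       zero       _   _    eq = inject₁-injective eq
  Towards-ends-injective zero       (suc zero) e<k k≤e′ eq = contradiction eq (inject₁≢suc e<k k≤e′)
  Towards-ends-injective (suc zero) zero       k≤e e′<k eq = contradiction (sym eq) (inject₁≢suc e′<k k≤e)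
  Towards-ends-injective (suc zero) (suc zero) _   _    eq = suc-injective eq

  gradientTo-isMatching : IsMatching (Path N) (gradientTo N k)
  gradientTo-isMatching h h′ h∈ h′∈ h≢h′ =
    differentEdges , differentEdges ∘ Towards-ends-injective (side h) (side h′) t t′
    where
    t  = ∈gradientTo⇒Towards h∈
    t′ = ∈gradientTo⇒Towards h′∈
    differentEdges : edgeOf (Path N) h ≢ edgeOf (Path N) h′
    differentEdges eq = h≢h′ (begin
      h                                           ≡⟨ combine-edgeOf-side h ⟨
      combine (edgeOf (Path N) h) (side h)        ≡⟨ cong₂ combine eq sameSide ⟩
      combine (edgeOf (Path N) h′) (side h′)      ≡⟨ combine-edgeOf-side h′ ⟩
      h′                                          ∎)
      where
      open ≡-Reasoning
      sameSide = Towards-functional (side h) (side h′) (subst (λ e → Towards _ e (side h)) eq t) t′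

  -- The Hasse diagram of a path is again a path, with vertex v at 2v and edge e at 2e + 1;
  -- every arc of gradientTo k moves one step closer to the critical vertex k.
  position : HNode (Path N) → ℕ
  position (inj₁ v) = 2 * toℕ v
  position (inj₂ e) = suc (2 * toℕ e)

  potential : ℕ → HNode (Path N) → ℕ
  potential k x = ∣ position x - 2 * k ∣

  matchedArc-descends : ∀ {e} i → Towards k e i →
                        potential k (inj₂ e) < potential k (inj₁ (ends (Path N) e i))
  matchedArc-descends {e = e} zero e<k rewrite toℕ-inject₁ e =
    ≤-reflexive (sym (∣m-n∣≡1+∣1+m-n∣ (*-monoʳ-< 2 e<k)))
  matchedArc-descends {e = e} (suc zero) k≤e rewrite *-suc 2 (toℕ e) =
    ≤-reflexive (sym (∣1+m-n∣≡1+∣m-n∣ (m≤n⇒m≤1+n (*-monoʳ-≤ 2 k≤e))))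

  unmatchedArc-descends : ∀ {e} i → ¬ Towards k e i →
                          potential k (inj₁ (ends (Path N) e i)) < potential k (inj₂ e)
  unmatchedArc-descends {e = e} zero e≮k rewrite toℕ-inject₁ e =
    ≤-reflexive (sym (∣1+m-n∣≡1+∣m-n∣ (*-monoʳ-≤ 2 (≮⇒≥ e≮k))))
  unmatchedArc-descends {k} {e = e} (suc zero) k≰e rewrite *-suc 2 (toℕ e) =
    ≤-reflexive (sym (∣m-n∣≡1+∣1+m-n∣ (subst (_≤ 2 * k) (*-suc 2 (toℕ e)) (*-monoʳ-≤ 2 (≰⇒> k≰e)))))

  gradientTo-isAcyclic : IsAcyclic (Path N) (gradientTo N k)
  gradientTo-isAcyclic {k} = isAcyclic-byPotential (potential k) descends
    where
    descends : ∀ {x y} → Arc (Path N) (gradientTo N k) x y → potential k y < potential k x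
    descends (up   h h∈) = matchedArc-descends (side h) (∈gradientTo⇒Towards h∈)
    descends (down h h∉) = unmatchedArc-descends (side h) (h∉ ∘ Towards⇒∈gradientTo)

  gradientTo-acyclicMatching : AcyclicMatching (Path N) (gradientTo N k)
  gradientTo-acyclicMatching = gradientTo-isMatching , gradientTo-isAcyclic

  isMatching⇒edgesMatchedOnce : ∀ {M} → IsMatching (Path N) M → EdgesMatchedOnce N M
  isMatching⇒edgesMatchedOnce matching e l∈ r∈ =
    proj₁ (matching (left e) (right e) l∈ r∈ (λ l≡r → 0≢1+n (combine-injectiveʳ e zero e (suc zero) l≡r)))
          (trans (edgeOf-combine e zero) (sym (edgeOf-combine e (suc zero))))

  isMatching⇒innerVerticesMatchedOnce : ∀ {M} → IsMatching (Path N) M → InnerVerticesMatchedOnce N M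
  isMatching⇒innerVerticesMatchedOnce matching e e′ 1+e≡e′ r∈ l∈ =
    proj₂ (matching (right e) (left e′) r∈ l∈
                    (λ r≡l → 0≢1+n (sym (combine-injectiveʳ e (suc zero) e′ zero r≡l))))
          (trans (endOf-combine e (suc zero)) (trans 1+e≡e′ (sym (endOf-combine e′ zero))))

  gradientTo-maximum : ∀ M → AcyclicMatching (Path N) M → ∣ M ∣ ≤ ∣ gradientTo N k ∣
  gradientTo-maximum {k} M (matching , _) =
    subst (∣ M ∣ ≤_) (sym (∣gradientTo∣≡N N k))
          (edgesMatchedOnce⇒∣M∣≤N N (isMatching⇒edgesMatchedOnce matching))

  maximum⇒gradientTo : ∀ {M} → AcyclicMatching (Path N) M →
                       (∀ M′ → AcyclicMatching (Path N) M′ → ∣ M′ ∣ ≤ ∣ M ∣) →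
                       ∃ λ k → k ≤ N × M ≡ gradientTo N k
  maximum⇒gradientTo {M} (matching , _) maximum =
    matchedOnce⇒gradientTo N (isMatching⇒edgesMatchedOnce matching)
                             (isMatching⇒innerVerticesMatchedOnce matching)
      (subst (_≤ ∣ M ∣) (∣gradientTo∣≡N N 0) (maximum (gradientTo N 0) gradientTo-acyclicMatching))

  GradientFaces : ℕ → Complex (N * 2)
  GradientFaces j ρ = Nonempty ρ × ∃ λ k → k ≤ j × ρ ⊆ gradientTo N k

  pureMorseComplex≐gradientFaces : PureMorseComplex (Path N) ≐ GradientFaces N
  pureMorseComplex≐gradientFaces = pure⇒gradient , gradient⇒pure
    where
    pure⇒gradient : ∀ {ρ} → PureMorseComplex (Path N) ρ → GradientFaces N ρ
    pure⇒gradient (ρ≠∅ , M , acyclicMatching , maximum , ρ⊆M)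
      with maximum⇒gradientTo acyclicMatching maximum
    ...   | k , k≤N , refl = ρ≠∅ , k , k≤N , ρ⊆M
    gradient⇒pure : ∀ {ρ} → GradientFaces N ρ → PureMorseComplex (Path N) ρ
    gradient⇒pure (ρ≠∅ , k , _ , ρ⊆) =
      ρ≠∅ , gradientTo N k , gradientTo-acyclicMatching , gradientTo-maximum , ρ⊆

  gradientFaces-downClosed : DownClosed (GradientFaces j)
  gradientFaces-downClosed (_ , k , k≤j , ρ⊆) ρ′≠∅ ρ′⊆ρ = ρ′≠∅ , k , k≤j , ρ⊆ ∘ ρ′⊆ρ

  gradientFaces-decidable : Decidable (GradientFaces j)
  gradientFaces-decidable {j} ρ =
    nonempty? ρ ×-dec map′ (λ (k , k<1+j , ρ⊆) → k , ≤-pred k<1+j , λ {x} → ρ⊆ {x})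
                           (λ (k , k≤j , ρ⊆) → k , s≤s k≤j , λ {x} → ρ⊆ {x})
                           (anyUpTo? (λ k → ρ ⊆? gradientTo N k) (suc j))

  gradientFaces-↘-pred : ∀ {w} (e : Fin N) → w ∈ gradientTo N (suc (toℕ e)) → w ≢ left e →
                         GradientFaces (suc (toℕ e)) ↘ GradientFaces (toℕ e)
  gradientFaces-↘-pred {w} e w∈ w≢l =
    ↘-respʳ-≐ (vertexDeletion-↘ gradientFaces-downClosed gradientFaces-decidable w≢l cone)
              (deleted⇒lower , lower⇒deleted)
    where
    cone : ∀ {ρ} → GradientFaces (suc (toℕ e)) ρ → left e ∈ ρ → GradientFaces (suc (toℕ e)) (ρ ∪ ⁅ w ⁆)
    cone ((x , x∈ρ) , k , k≤1+e , ρ⊆) l∈ρ with ≤-antisym k≤1+e (left∈gradientTo⁻ (ρ⊆ l∈ρ))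
    ... | refl = (x , p⊆p∪q ⁅ w ⁆ x∈ρ) , suc (toℕ e) , ≤-refl , p⊆q∧x∈q⇒p∪⁅x⁆⊆q ρ⊆ w∈
    deleted⇒lower : ∀ {ρ} → GradientFaces (suc (toℕ e)) ρ × left e ∉ ρ → GradientFaces (toℕ e) ρ
    deleted⇒lower ((ρ≠∅ , k , k≤1+e , ρ⊆) , l∉ρ) with m≤n⇒m<n∨m≡n k≤1+e
    ... | inj₁ k<1+e = ρ≠∅ , k , ≤-pred k<1+e , ρ⊆
    ... | inj₂ refl  = ρ≠∅ , toℕ e , ≤-refl , λ x∈ρ → gradientTo-suc-⊆ e (ρ⊆ x∈ρ) λ { refl → l∉ρ x∈ρ }
    lower⇒deleted : ∀ {ρ} → GradientFaces (toℕ e) ρ → GradientFaces (suc (toℕ e)) ρ × left e ∉ ρ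
    lower⇒deleted (ρ≠∅ , k , k≤e , ρ⊆) =
      (ρ≠∅ , k , m≤n⇒m≤1+n k≤e , ρ⊆) , λ l∈ρ → <⇒≱ (left∈gradientTo⁻ (ρ⊆ l∈ρ)) k≤e

  gradientFaces-zero≐simplex : GradientFaces 0 ≐ Simplex (gradientTo N 0)
  gradientFaces-zero≐simplex =
    (λ { (ρ≠∅ , _ , z≤n , ρ⊆) → ρ≠∅ , ρ⊆ }) , λ (ρ≠∅ , ρ⊆) → ρ≠∅ , 0 , z≤n , ρ⊆

-- N ≥ 2 is needed here: for e = 0 the apex must be a vertex of Δ₁ other than left 0.
linkApex : ∀ n (e : Fin (2 + n)) → ∃ λ w → w ∈ gradientTo (2 + n) (suc (toℕ e)) × w ≢ left e
linkApex n zero    = right {2 + n} (suc zero) , there (there (there here)) , λ ()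
linkApex n (suc e) = left {2 + n} zero , here , λ ()

gradientFaces-↘-zero : ∀ n j → j ≤ 2 + n → GradientFaces (2 + n) j ↘ GradientFaces (2 + n) 0
gradientFaces-↘-zero n zero    _   = ↘-reflexive ≐-refl
gradientFaces-↘-zero n (suc j) j<N =
  ↘-trans (subst (λ i → GradientFaces (2 + n) (suc i) ↘ GradientFaces (2 + n) i) (toℕ-fromℕ< j<N)
                 step)
          (gradientFaces-↘-zero n j (<⇒≤ j<N))
  where
  e = fromℕ< j<N
  step : GradientFaces (2 + n) (suc (toℕ e)) ↘ GradientFaces (2 + n) (toℕ e)
  step = let (w , w∈ , w≢l) = linkApex n e in gradientFaces-↘-pred (2 + n) e w∈ w≢l

lemma8 : (n : ℕ) → 2 < n → Collapsible (PureMorseComplex (PathGraph n))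
lemma8 (suc (suc (suc n))) (s≤s (s≤s (s≤s _))) = ↘-vertex⇒collapsible {v = right {2 + n} zero} pure↘vertex
  where
  pure↘vertex : PureMorseComplex (Path (2 + n)) ↘ (_≡ ⁅ right {2 + n} zero ⁆)
  pure↘vertex =
    ↘-respˡ-≐ (pureMorseComplex≐gradientFaces (2 + n))
      (↘-trans (gradientFaces-↘-zero n (2 + n) ≤-refl)
               (↘-respˡ-≐ (gradientFaces-zero≐simplex (2 + n))
                          (simplex-↘-vertex (right∈gradientTo⁺ {e = zero} z≤n))))
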